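{- Let $q$ be a prime power with $q>3$ and let $D\in\mathbb{F}_q[t]$ be monic squarefree. If $-4/27$ is a quadratic non-residue in $\mathbb{F}_q$, then every irreducible factor over $\mathbb{F}_q$ of $\Delta_0(t)=4+27D(t)^2$ has even degree.
   Context: $\Delta_0$ is (up to the constant $-16$) the discriminant of the curve $y^2=x^3+x+D(t)$ over $\mathbb{F}_q(t)$. -}

module Defs where

open import Level using (Level; _⊔_) renaming (suc to lsuc)
open import Algebra.Bundles using (CommutativeRing)
open import Data.Nat as ℕ using (ℕ; zero; suc)
open import Data.Nat.Primality using (Prime)
open import Data.Fin using (Fin)
open import Data.List using (List; []; _∷_; map)
open import Data.Product using (Σ; ∃; _×_; _,_)
open import Data.Sum using (_⊎_)
open import Relation.Nullary using (¬_)
open import Relation.Binary.PropositionalEquality using (_≡_)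

IsPrimePower : ℕ → Set
IsPrimePower q = Σ ℕ λ p → Σ ℕ λ k → Prime p × q ≡ p ℕ.^ suc k

record FiniteField (c ℓ : Level) (q : ℕ) : Set (lsuc (c ⊔ ℓ)) where
  field
    commRing : CommutativeRing c ℓ
  open CommutativeRing commRing public
  field
    1≉0     : ¬ (1# ≈ 0#)
    inverse : ∀ x → ¬ (x ≈ 0#) → ∃ λ y → x * y ≈ 1#
    enum    : Fin q → Carrier
    enum-inj : ∀ i j → enum i ≈ enum j → i ≡ j
    enum-surj : ∀ x → ∃ λ i → enum i ≈ x

module Polynomials {c ℓ : Level} {q : ℕ} (F : FiniteField c ℓ q) where
  open FiniteField F

  -- polynomials over F as coefficient lists, lowest degree first
  Poly : Set c
  Poly = List Carrier

  coeff : Poly → ℕ → Carrier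
  coeff []       n       = 0#
  coeff (a ∷ f)  zero    = a
  coeff (a ∷ f)  (suc n) = coeff f n

  _≈ₚ_ : Poly → Poly → Set ℓ
  f ≈ₚ g = ∀ n → coeff f n ≈ coeff g n

  _+ₚ_ : Poly → Poly → Poly
  []      +ₚ g       = g
  (a ∷ f) +ₚ []      = a ∷ f
  (a ∷ f) +ₚ (b ∷ g) = (a + b) ∷ (f +ₚ g)

  _*ₚ_ : Poly → Poly → Poly
  []      *ₚ g = []
  (a ∷ f) *ₚ g = map (a *_) g +ₚ (0# ∷ (f *ₚ g))

  fromℕ : ℕ → Carrier
  fromℕ zero    = 0#
  fromℕ (suc n) = 1# + fromℕ n

  const : Carrier → Poly
  const a = a ∷ []

  HasDegree : Poly → ℕ → Set ℓ
  HasDegree f n = ¬ (coeff f n ≈ 0#) × (∀ m → n ℕ.< m → coeff f m ≈ 0#)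

  Monic : Poly → Set ℓ
  Monic f = Σ ℕ λ n → HasDegree f n × coeff f n ≈ 1#

  _∣ₚ_ : Poly → Poly → Set (c ⊔ ℓ)
  f ∣ₚ g = ∃ λ h → (f *ₚ h) ≈ₚ g

  -- units of F[t] are the nonzero constants
  IsUnit : Poly → Set ℓ
  IsUnit f = HasDegree f 0

  Squarefree : Poly → Set (c ⊔ ℓ)
  Squarefree f = ∀ g → (g *ₚ g) ∣ₚ f → IsUnit g

  Irreducible : Poly → Set (c ⊔ ℓ)
  Irreducible f = (Σ ℕ λ n → HasDegree f n × 0 ℕ.< n)
                × (∀ g h → f ≈ₚ (g *ₚ h) → IsUnit g ⊎ IsUnit h)

  NonResidue : Carrier → Set (c ⊔ ℓ)
  NonResidue a = ¬ (a ≈ 0#) × ¬ (∃ λ x → x * x ≈ a)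

  Δ₀ : Poly → Poly
  Δ₀ D = const (fromℕ 4) +ₚ (const (fromℕ 27) *ₚ (D *ₚ D))

-- Since 27 is invertible, f ∣ Δ₀ = 4 + 27 D² says that f divides D² − a with a = −4/27, so it
-- suffices to show: if a polynomial f of odd degree n divides g² − a, then a is a square in F.
-- Reduce g modulo f to r with deg r < n; then f h' = r² − a for a new cofactor h'.  If h' = 0,
-- a is the square of the constant term of r.  Otherwise n + deg h' = 2 deg r < 2n, so h' is a
-- divisor of r² − a of odd degree below n, and we descend.
module Submission where

open import Data.Nat using (ℕ; _<_; _%_)
open import Relation.Binary.PropositionalEquality using (_≡_)

open import Defs
open import Level using (Level)
open import Data.Nat as ℕ using (zero; suc; _≤_; z≤n; s≤s)
open import Data.Nat.Properties as ℕ using ()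
open import Data.Nat.DivMod using (%-distribˡ-+; m*n%n≡0; m%n<n)
open import Data.Nat.Induction using (<-wellFounded)
open import Data.List using ([]; _∷_; map)
open import Data.Product using (∃; ∃₂; _×_; _,_; proj₁; proj₂)
open import Data.Sum using (_⊎_; inj₁; inj₂)
open import Relation.Binary.Definitions using (tri<; tri≈; tri>)
open import Relation.Nullary using (¬_; Dec; yes; no; contradiction)
open import Relation.Binary.PropositionalEquality as ≡ using (cong; module ≡-Reasoning)
open import Induction.WellFounded using (Acc; acc)
import Data.Fin as Fin
open import Algebra.Bundles using (CommutativeRing)
import Algebra.Properties.Ring as RingProperties
import Algebra.Properties.AbelianGroup as AbelianGroupProperties
import Algebra.Solver.Ring.NaturalCoefficients.Default as NaturalCoefficientsSolver
import Relation.Binary.Reasoning.Setoid as SetoidReasoning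

m+m%2≡0 : ∀ m → (m ℕ.+ m) % 2 ≡ 0
m+m%2≡0 m = ≡.trans (cong (_% 2) m+m≡m*2) (m*n%n≡0 m 2)
  where
  m+m≡m*2 : m ℕ.+ m ≡ m ℕ.* 2
  m+m≡m*2 = ≡.trans (cong (m ℕ.+_) (≡.sym (ℕ.+-identityʳ m))) (ℕ.*-comm 2 m)

odd⇒0< : ∀ {n} → n % 2 ≡ 1 → 0 < n
odd⇒0< {zero}  ()
odd⇒0< {suc n} _ = s≤s z≤n

odd-summand : ∀ {n d m} → n % 2 ≡ 1 → n ℕ.+ d ≡ m ℕ.+ m → d % 2 ≡ 1
odd-summand {n} {d} {m} n-odd n+d≡m+m = remainder≡1 (d % 2) (m%n<n d 2) 1+d%2≡0
  where
  remainder≡1 : ∀ r → r < 2 → (1 ℕ.+ r) % 2 ≡ 0 → r ≡ 1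
  remainder≡1 0 _ ()
  remainder≡1 1 _ _ = ≡.refl
  remainder≡1 (suc (suc r)) (s≤s (s≤s ())) _
  open ≡-Reasoning
  1+d%2≡0 : (1 ℕ.+ d % 2) % 2 ≡ 0
  1+d%2≡0 = begin
    (1 ℕ.+ d % 2) % 2             ≡⟨ cong (λ x → (x ℕ.+ d % 2) % 2) n-odd ⟨
    (n % 2 ℕ.+ d % 2) % 2         ≡⟨ %-distribˡ-+ n d 2 ⟨
    (n ℕ.+ d) % 2                 ≡⟨ cong (_% 2) n+d≡m+m ⟩
    (m ℕ.+ m) % 2                 ≡⟨ m+m%2≡0 m ⟩
    0                             ∎

module CommutativeRingIdentities {c ℓ : Level} (R : CommutativeRing c ℓ) where
  open CommutativeRing R
  open RingProperties ring using (-‿distribˡ-*; -‿distribʳ-*)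
  open AbelianGroupProperties +-abelianGroup using (xyx⁻¹≈y)
  open NaturalCoefficientsSolver commutativeSemiring using (solve; _:=_; _:+_; _:*_)
  open SetoidReasoning setoid

  remainder-square : ∀ {f h g s r a} → f * h + a ≈ g * g → g ≈ f * s + r →
                     f * (h - s * (g + r)) + a ≈ r * r
  remainder-square {f} {h} {g} {s} {r} {a} fh+a≈g² g≈fs+r = begin
    f * (h - s * (g + r)) + a          ≈⟨ +-cong (trans (distribˡ f h _) (+-cong refl (sym (-‿distribʳ-* f _)))) refl ⟩
    (f * h + - fX) + a                 ≈⟨ solve 3 (λ fh nfX a → (fh :+ nfX) :+ a := (fh :+ a) :+ nfX) refl (f * h) (- fX) a ⟩
    (f * h + a) + - fX                 ≈⟨ +-cong (trans fh+a≈g² g²≈fX+r²) refl ⟩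
    (fX + r * r) + - fX                ≈⟨ xyx⁻¹≈y fX (r * r) ⟩
    r * r                              ∎
    where
    fX : Carrier
    fX = f * (s * (g + r))
    g²≈fX+r² : g * g ≈ fX + r * r
    g²≈fX+r² = begin
      g * g                            ≈⟨ *-cong refl g≈fs+r ⟩
      g * (f * s + r)                  ≈⟨ solve 4 (λ f g s r → g :* (f :* s :+ r) := f :* (s :* g) :+ g :* r) refl f g s r ⟩
      f * (s * g) + g * r              ≈⟨ +-cong refl (*-cong g≈fs+r refl) ⟩
      f * (s * g) + (f * s + r) * r    ≈⟨ solve 4 (λ f g s r → f :* (s :* g) :+ (f :* s :+ r) :* r := f :* (s :* (g :+ r)) :+ r :* r) refl f g s r ⟩
      fX + r * r                       ∎

  x≈y+z⇒x≈w+y+[z-w] : ∀ {x y z} w → x ≈ y + z → x ≈ (w + y) + (z - w)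
  x≈y+z⇒x≈w+y+[z-w] {x} {y} {z} w x≈y+z = begin
    x                        ≈⟨ x≈y+z ⟩
    y + z                    ≈⟨ +-identityʳ (y + z) ⟨
    (y + z) + 0#             ≈⟨ +-cong refl (-‿inverseʳ w) ⟨
    (y + z) + (w - w)        ≈⟨ solve 4 (λ y z w nw → (y :+ z) :+ (w :+ nw) := (w :+ y) :+ (z :+ nw)) refl y z w (- w) ⟩
    (w + y) + (z - w)        ∎

  scaled-divisor : ∀ {t u x d f h} → t * u ≈ 1# → f * h ≈ x + t * d → f * (u * h) + - x * u ≈ d
  scaled-divisor {t} {u} {x} {d} {f} {h} tu≈1 fh≈x+td = begin
    f * (u * h) + - x * u              ≈⟨ +-cong (solve 3 (λ f u h → f :* (u :* h) := u :* (f :* h)) refl f u h) (sym (-‿distribˡ-* x u)) ⟩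
    u * (f * h) + - (x * u)            ≈⟨ +-cong (*-cong refl fh≈x+td) refl ⟩
    u * (x + t * d) + - (x * u)        ≈⟨ +-cong (solve 4 (λ t u x d → u :* (x :+ t :* d) := x :* u :+ (t :* u) :* d) refl t u x d) refl ⟩
    (x * u + (t * u) * d) + - (x * u)  ≈⟨ +-cong (+-cong refl (trans (*-cong tu≈1 refl) (*-identityˡ d))) refl ⟩
    (x * u + d) + - (x * u)            ≈⟨ xyx⁻¹≈y (x * u) d ⟩
    d                                  ∎

module _ {c ℓ : Level} {q : ℕ} (F : FiniteField c ℓ q) where
  open FiniteField F
  open Polynomials F
  open RingProperties ring using (-0#≈0#)
  open NaturalCoefficientsSolver commutativeSemiring using (solve; _:=_; _:+_; _:*_)
  open SetoidReasoning setoid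

  ≈0? : ∀ x → Dec (x ≈ 0#)
  ≈0? x with enum-surj x | enum-surj 0#
  ... | i , i↦x | j , j↦0 with i Fin.≟ j
  ...   | yes ≡.refl = yes (trans (sym i↦x) j↦0)
  ...   | no i≢j     = no λ x≈0 → i≢j (enum-inj i j (trans i↦x (trans x≈0 (sym j↦0))))

  *-≉0 : ∀ {x y} → ¬ x ≈ 0# → ¬ y ≈ 0# → ¬ x * y ≈ 0#
  *-≉0 {x} {y} x≉0 y≉0 xy≈0 with inverse x x≉0
  ... | x⁻¹ , xx⁻¹≈1 = y≉0 (begin
    y                ≈⟨ sym (*-identityˡ y) ⟩
    1# * y           ≈⟨ *-cong (sym xx⁻¹≈1) refl ⟩
    (x * x⁻¹) * y    ≈⟨ solve 3 (λ x x⁻¹ y → (x :* x⁻¹) :* y := x⁻¹ :* (x :* y)) refl x x⁻¹ y ⟩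
    x⁻¹ * (x * y)    ≈⟨ *-cong refl xy≈0 ⟩
    x⁻¹ * 0#         ≈⟨ zeroʳ x⁻¹ ⟩
    0#               ∎)

  -- The polynomial ring F[t]

  -- _≈ₚ_ unfolds to a function type, from which Agda cannot infer the two polynomials.
  infix 4 _≋_
  record _≋_ (f g : Poly) : Set ℓ where
    constructor mk≋
    field coeff-≈ : f ≈ₚ g
  open _≋_ public

  ≋-refl : ∀ {f} → f ≋ f
  ≋-refl = mk≋ λ _ → refl

  ≋-sym : ∀ {f g} → f ≋ g → g ≋ f
  ≋-sym (mk≋ e) = mk≋ λ n → sym (e n)

  ≋-trans : ∀ {f g h} → f ≋ g → g ≋ h → f ≋ h
  ≋-trans (mk≋ e) (mk≋ e') = mk≋ λ n → trans (e n) (e' n)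

  infix 21 -ₚ_
  -ₚ_ : Poly → Poly
  -ₚ_ = map (λ x → - x)

  coeff-+ₚ : ∀ f g n → coeff (f +ₚ g) n ≈ coeff f n + coeff g n
  coeff-+ₚ []      g       n       = sym (+-identityˡ _)
  coeff-+ₚ (a ∷ f) []      n       = sym (+-identityʳ _)
  coeff-+ₚ (a ∷ f) (b ∷ g) zero    = refl
  coeff-+ₚ (a ∷ f) (b ∷ g) (suc n) = coeff-+ₚ f g n

  coeff-scale : ∀ a g n → coeff (map (a *_) g) n ≈ a * coeff g n
  coeff-scale a []      n       = sym (zeroʳ a)
  coeff-scale a (b ∷ g) zero    = refl
  coeff-scale a (b ∷ g) (suc n) = coeff-scale a g n

  coeff--ₚ : ∀ g n → coeff (-ₚ g) n ≈ - coeff g n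
  coeff--ₚ []      n       = sym -0#≈0#
  coeff--ₚ (b ∷ g) zero    = refl
  coeff--ₚ (b ∷ g) (suc n) = coeff--ₚ g n

  coeff-∷*ₚ : ∀ a f g n → coeff ((a ∷ f) *ₚ g) n ≈ a * coeff g n + coeff (0# ∷ (f *ₚ g)) n
  coeff-∷*ₚ a f g n = trans (coeff-+ₚ (map (a *_) g) _ n) (+-cong (coeff-scale a g n) refl)

  ∷-cong : ∀ {a b f g} → a ≈ b → f ≋ g → (a ∷ f) ≋ (b ∷ g)
  ∷-cong a≈b (mk≋ e) = mk≋ λ { zero → a≈b ; (suc n) → e n }

  +ₚ-cong : ∀ {f f' g g'} → f ≋ f' → g ≋ g' → (f +ₚ g) ≋ (f' +ₚ g')
  +ₚ-cong {f} {f'} {g} {g'} (mk≋ e) (mk≋ e') = mk≋ λ n → begin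
    coeff (f +ₚ g) n         ≈⟨ coeff-+ₚ f g n ⟩
    coeff f n + coeff g n    ≈⟨ +-cong (e n) (e' n) ⟩
    coeff f' n + coeff g' n  ≈⟨ coeff-+ₚ f' g' n ⟨
    coeff (f' +ₚ g') n       ∎

  -ₚ-cong : ∀ {f f'} → f ≋ f' → -ₚ f ≋ -ₚ f'
  -ₚ-cong {f} {f'} (mk≋ e) = mk≋ λ n → trans (coeff--ₚ f n) (trans (-‿cong (e n)) (sym (coeff--ₚ f' n)))

  scale-cong : ∀ {a b f g} → a ≈ b → f ≋ g → map (a *_) f ≋ map (b *_) g
  scale-cong {a} {b} {f} {g} a≈b (mk≋ e) = mk≋ λ n →
    trans (coeff-scale a f n) (trans (*-cong a≈b (e n)) (sym (coeff-scale b g n)))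

  +ₚ-assoc : ∀ f g h → ((f +ₚ g) +ₚ h) ≋ (f +ₚ (g +ₚ h))
  +ₚ-assoc f g h = mk≋ λ n → begin
    coeff ((f +ₚ g) +ₚ h) n               ≈⟨ trans (coeff-+ₚ (f +ₚ g) h n) (+-cong (coeff-+ₚ f g n) refl) ⟩
    (coeff f n + coeff g n) + coeff h n   ≈⟨ +-assoc _ _ _ ⟩
    coeff f n + (coeff g n + coeff h n)   ≈⟨ trans (coeff-+ₚ f (g +ₚ h) n) (+-cong refl (coeff-+ₚ g h n)) ⟨
    coeff (f +ₚ (g +ₚ h)) n               ∎

  +ₚ-comm : ∀ f g → (f +ₚ g) ≋ (g +ₚ f)
  +ₚ-comm f g = mk≋ λ n → trans (coeff-+ₚ f g n) (trans (+-comm _ _) (sym (coeff-+ₚ g f n)))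

  +ₚ-identityˡ : ∀ f → ([] +ₚ f) ≋ f
  +ₚ-identityˡ f = ≋-refl

  +ₚ-identityʳ : ∀ f → (f +ₚ []) ≋ f
  +ₚ-identityʳ f = mk≋ λ n → trans (coeff-+ₚ f [] n) (+-identityʳ _)

  -ₚ‿inverseʳ : ∀ f → (f +ₚ -ₚ f) ≋ []
  -ₚ‿inverseʳ f = mk≋ λ n → trans (coeff-+ₚ f (-ₚ f) n) (trans (+-cong refl (coeff--ₚ f n)) (-‿inverseʳ _))

  -ₚ‿inverseˡ : ∀ f → (-ₚ f +ₚ f) ≋ []
  -ₚ‿inverseˡ f = ≋-trans (+ₚ-comm (-ₚ f) f) (-ₚ‿inverseʳ f)

  +ₚ-middle-swap : ∀ f g h k → ((f +ₚ g) +ₚ (h +ₚ k)) ≋ ((f +ₚ h) +ₚ (g +ₚ k))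
  +ₚ-middle-swap f g h k = mk≋ λ n → begin
    coeff ((f +ₚ g) +ₚ (h +ₚ k)) n
      ≈⟨ trans (coeff-+ₚ (f +ₚ g) _ n) (+-cong (coeff-+ₚ f g n) (coeff-+ₚ h k n)) ⟩
    (coeff f n + coeff g n) + (coeff h n + coeff k n)
      ≈⟨ solve 4 (λ f g h k → (f :+ g) :+ (h :+ k) := (f :+ h) :+ (g :+ k)) refl (coeff f n) (coeff g n) (coeff h n) (coeff k n) ⟩
    (coeff f n + coeff h n) + (coeff g n + coeff k n)
      ≈⟨ trans (coeff-+ₚ (f +ₚ h) _ n) (+-cong (coeff-+ₚ f h n) (coeff-+ₚ g k n)) ⟨
    coeff ((f +ₚ h) +ₚ (g +ₚ k)) n
      ∎

  +ₚ-swap : ∀ f g h → (f +ₚ (g +ₚ h)) ≋ (g +ₚ (f +ₚ h))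
  +ₚ-swap f g h = ≋-trans (≋-sym (+ₚ-assoc f g h))
    (≋-trans (+ₚ-cong (+ₚ-comm f g) (≋-refl {h})) (+ₚ-assoc g f h))

  0∷[]≋[] : (0# ∷ []) ≋ []
  0∷[]≋[] = mk≋ λ { zero → refl ; (suc n) → refl }

  0∷-+ₚ : ∀ f g → (0# ∷ (f +ₚ g)) ≋ ((0# ∷ f) +ₚ (0# ∷ g))
  0∷-+ₚ f g = ∷-cong (sym (+-identityˡ 0#)) ≋-refl

  scale-+ₚ : ∀ a f g → map (a *_) (f +ₚ g) ≋ (map (a *_) f +ₚ map (a *_) g)
  scale-+ₚ a f g = mk≋ λ n → begin
    coeff (map (a *_) (f +ₚ g)) n        ≈⟨ trans (coeff-scale a (f +ₚ g) n) (*-cong refl (coeff-+ₚ f g n)) ⟩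
    a * (coeff f n + coeff g n)          ≈⟨ distribˡ _ _ _ ⟩
    a * coeff f n + a * coeff g n        ≈⟨ trans (coeff-+ₚ (map (a *_) f) _ n) (+-cong (coeff-scale a f n) (coeff-scale a g n)) ⟨
    coeff (map (a *_) f +ₚ map (a *_) g) n ∎

  scale-scale : ∀ a b f → map (a *_) (map (b *_) f) ≋ map ((a * b) *_) f
  scale-scale a b f = mk≋ λ n → begin
    coeff (map (a *_) (map (b *_) f)) n  ≈⟨ trans (coeff-scale a (map (b *_) f) n) (*-cong refl (coeff-scale b f n)) ⟩
    a * (b * coeff f n)                  ≈⟨ *-assoc a b _ ⟨
    (a * b) * coeff f n                  ≈⟨ coeff-scale (a * b) f n ⟨
    coeff (map ((a * b) *_) f) n         ∎

  scale-0# : ∀ f → map (0# *_) f ≋ []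
  scale-0# f = mk≋ λ n → trans (coeff-scale 0# f n) (zeroˡ _)

  scale-1# : ∀ f → map (1# *_) f ≋ f
  scale-1# f = mk≋ λ n → trans (coeff-scale 1# f n) (*-identityˡ _)

  const-*ₚ : ∀ a f → (const a *ₚ f) ≋ map (a *_) f
  const-*ₚ a f = ≋-trans (+ₚ-cong (≋-refl {map (a *_) f}) 0∷[]≋[]) (+ₚ-identityʳ _)

  *ₚ-congʳ : ∀ f {g g'} → g ≋ g' → (f *ₚ g) ≋ (f *ₚ g')
  *ₚ-congʳ []      g≋g' = ≋-refl
  *ₚ-congʳ (a ∷ f) g≋g' = +ₚ-cong (scale-cong refl g≋g') (∷-cong refl (*ₚ-congʳ f g≋g'))

  *ₚ-zeroʳ : ∀ f → (f *ₚ []) ≋ []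
  *ₚ-zeroʳ []      = ≋-refl
  *ₚ-zeroʳ (a ∷ f) = ≋-trans (∷-cong refl (*ₚ-zeroʳ f)) 0∷[]≋[]

  *ₚ-∷ʳ : ∀ f a g → (f *ₚ (a ∷ g)) ≋ (map (a *_) f +ₚ (0# ∷ (f *ₚ g)))
  *ₚ-∷ʳ []      a g = ≋-sym 0∷[]≋[]
  *ₚ-∷ʳ (b ∷ f) a g = ∷-cong (+-cong (*-comm b a) refl)
    (≋-trans (+ₚ-cong (≋-refl {map (b *_) g}) (*ₚ-∷ʳ f a g)) (+ₚ-swap (map (b *_) g) (map (a *_) f) _))

  *ₚ-comm : ∀ f g → (f *ₚ g) ≋ (g *ₚ f)
  *ₚ-comm []      g = ≋-sym (*ₚ-zeroʳ g)
  *ₚ-comm (a ∷ f) g = ≋-trans (+ₚ-cong (≋-refl {map (a *_) g}) (∷-cong refl (*ₚ-comm f g))) (≋-sym (*ₚ-∷ʳ g a f))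

  *ₚ-cong : ∀ {f f' g g'} → f ≋ f' → g ≋ g' → (f *ₚ g) ≋ (f' *ₚ g')
  *ₚ-cong {f} {f'} {g} {g'} f≋f' g≋g' =
    ≋-trans (*ₚ-congʳ f g≋g') (≋-trans (*ₚ-comm f g') (≋-trans (*ₚ-congʳ g' f≋f') (*ₚ-comm g' f')))

  *ₚ-distribˡ : ∀ f g h → (f *ₚ (g +ₚ h)) ≋ ((f *ₚ g) +ₚ (f *ₚ h))
  *ₚ-distribˡ []      g h = ≋-refl
  *ₚ-distribˡ (a ∷ f) g h = ≋-trans
    (+ₚ-cong (scale-+ₚ a g h) (≋-trans (∷-cong refl (*ₚ-distribˡ f g h)) (0∷-+ₚ (f *ₚ g) (f *ₚ h))))
    (+ₚ-middle-swap (map (a *_) g) (map (a *_) h) (0# ∷ (f *ₚ g)) (0# ∷ (f *ₚ h)))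

  *ₚ-distribʳ : ∀ f g h → ((g +ₚ h) *ₚ f) ≋ ((g *ₚ f) +ₚ (h *ₚ f))
  *ₚ-distribʳ f g h = ≋-trans (*ₚ-comm (g +ₚ h) f)
    (≋-trans (*ₚ-distribˡ f g h) (+ₚ-cong (*ₚ-comm f g) (*ₚ-comm f h)))

  *ₚ-scaleˡ : ∀ a f g → (map (a *_) f *ₚ g) ≋ map (a *_) (f *ₚ g)
  *ₚ-scaleˡ a []      g = ≋-refl
  *ₚ-scaleˡ a (b ∷ f) g = ≋-sym (≋-trans (scale-+ₚ a (map (b *_) g) (0# ∷ (f *ₚ g)))
    (+ₚ-cong (scale-scale a b g) (∷-cong (zeroʳ a) (≋-sym (*ₚ-scaleˡ a f g)))))

  *ₚ-assoc : ∀ f g h → ((f *ₚ g) *ₚ h) ≋ (f *ₚ (g *ₚ h))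
  *ₚ-assoc []      g h = ≋-refl
  *ₚ-assoc (a ∷ f) g h = ≋-trans (*ₚ-distribʳ h (map (a *_) g) (0# ∷ (f *ₚ g)))
    (+ₚ-cong (*ₚ-scaleˡ a g h) (≋-trans shiftˡ (∷-cong refl (*ₚ-assoc f g h))))
    where
    shiftˡ : ((0# ∷ (f *ₚ g)) *ₚ h) ≋ (0# ∷ ((f *ₚ g) *ₚ h))
    shiftˡ = +ₚ-cong (scale-0# h) ≋-refl

  *ₚ-identityˡ : ∀ f → (const 1# *ₚ f) ≋ f
  *ₚ-identityˡ f = ≋-trans (const-*ₚ 1# f) (scale-1# f)

  *ₚ-identityʳ : ∀ f → (f *ₚ const 1#) ≋ f
  *ₚ-identityʳ f = ≋-trans (*ₚ-comm f (const 1#)) (*ₚ-identityˡ f)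

  Poly-commutativeRing : CommutativeRing c ℓ
  Poly-commutativeRing = record
    { Carrier = Poly ; _≈_ = _≋_ ; _+_ = _+ₚ_ ; _*_ = _*ₚ_ ; -_ = -ₚ_ ; 0# = [] ; 1# = const 1#
    ; isCommutativeRing = record
      { isRing = record
        { +-isAbelianGroup = record
          { isGroup = record
            { isMonoid = record
              { isSemigroup = record
                { isMagma = record
                  { isEquivalence = record { refl = ≋-refl ; sym = ≋-sym ; trans = ≋-trans }
                  ; ∙-cong = +ₚ-cong }
                ; assoc = +ₚ-assoc }
              ; identity = +ₚ-identityˡ , +ₚ-identityʳ }
            ; inverse = -ₚ‿inverseˡ , -ₚ‿inverseʳ
            ; ⁻¹-cong = -ₚ-cong }
          ; comm = +ₚ-comm }
        ; *-cong = *ₚ-cong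
        ; *-assoc = *ₚ-assoc
        ; *-identity = *ₚ-identityˡ , *ₚ-identityʳ
        ; distrib = *ₚ-distribˡ , *ₚ-distribʳ }
      ; *-comm = *ₚ-comm } }

  module ℙ = CommutativeRing Poly-commutativeRing

  const-cong : ∀ {a b} → a ≈ b → const a ≋ const b
  const-cong a≈b = ∷-cong a≈b ≋-refl

  const-* : ∀ a b → const (a * b) ≋ (const a *ₚ const b)
  const-* a b = ∷-cong (sym (+-identityʳ _)) ≋-refl

  coeff-*ₚ-0 : ∀ f g → coeff (f *ₚ g) 0 ≈ coeff f 0 * coeff g 0
  coeff-*ₚ-0 []      g = sym (zeroˡ _)
  coeff-*ₚ-0 (a ∷ f) g = trans (coeff-∷*ₚ a f g 0) (+-identityʳ _)

  -- Degrees

  VanishesFrom : Poly → ℕ → Set ℓ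
  VanishesFrom f n = ∀ k → n ≤ k → coeff f k ≈ 0#

  HasDegree-cong : ∀ {f g n} → f ≋ g → HasDegree f n → HasDegree g n
  HasDegree-cong (mk≋ e) (fₙ≉0 , f-vanishes) =
    (λ gₙ≈0 → fₙ≉0 (trans (e _) gₙ≈0)) , λ k n<k → trans (sym (e k)) (f-vanishes k n<k)

  HasDegree-unique : ∀ {f m n} → HasDegree f m → HasDegree f n → m ≡ n
  HasDegree-unique {m = m} {n} (fₘ≉0 , f>m≈0) (fₙ≉0 , f>n≈0) with ℕ.<-cmp m n
  ... | tri< m<n _ _ = contradiction (f>m≈0 n m<n) fₙ≉0
  ... | tri≈ _ m≡n _ = m≡n
  ... | tri> _ _ n<m = contradiction (f>n≈0 m n<m) fₘ≉0

  ≋[]⇒¬HasDegree : ∀ {f n} → f ≋ [] → ¬ HasDegree f n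
  ≋[]⇒¬HasDegree (mk≋ e) (fₙ≉0 , _) = fₙ≉0 (e _)

  ≋[]⊎HasDegree : ∀ f → f ≋ [] ⊎ ∃ (HasDegree f)
  ≋[]⊎HasDegree []      = inj₁ ≋-refl
  ≋[]⊎HasDegree (a ∷ f) with ≋[]⊎HasDegree f | ≈0? a
  ... | inj₂ (d , fd≉0 , f>d≈0) | _       = inj₂ (suc d , fd≉0 , λ { (suc k) (s≤s d<k) → f>d≈0 k d<k })
  ... | inj₁ f≋[]               | yes a≈0 = inj₁ (≋-trans (∷-cong a≈0 f≋[]) 0∷[]≋[])
  ... | inj₁ (mk≋ f≈0)          | no a≉0  = inj₂ (0 , a≉0 , λ { (suc k) _ → f≈0 k })

  HasDegree-+ₚ-const : ∀ {f n} a → 0 < n → HasDegree f n → HasDegree (f +ₚ const a) n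
  HasDegree-+ₚ-const {f} a (s≤s _) (fₙ≉0 , f>n≈0) =
    (λ e → fₙ≉0 (trans (sym (coeff-+ₚ-const _)) e)) ,
    λ { (suc k) n<k → trans (coeff-+ₚ-const k) (f>n≈0 (suc k) n<k) }
    where
    coeff-+ₚ-const : ∀ k → coeff (f +ₚ const a) (suc k) ≈ coeff f (suc k)
    coeff-+ₚ-const k = trans (coeff-+ₚ f (const a) (suc k)) (+-identityʳ _)

  *ₚ-leading : ∀ m n f g → VanishesFrom f (suc m) → VanishesFrom g (suc n) →
               coeff (f *ₚ g) (m ℕ.+ n) ≈ coeff f m * coeff g n × VanishesFrom (f *ₚ g) (suc (m ℕ.+ n))
  *ₚ-leading m n [] g _ _ = sym (zeroˡ _) , λ _ _ → refl
  *ₚ-leading zero n (a ∷ f) g f-vanishes g-vanishes =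
    coeff-ag n , λ k n<k → trans (coeff-ag k) (trans (*-cong refl (g-vanishes k n<k)) (zeroʳ a))
    where
    f≋[] : f ≋ []
    f≋[] = mk≋ λ k → f-vanishes (suc k) (s≤s z≤n)
    fg≋[] : (0# ∷ (f *ₚ g)) ≋ []
    fg≋[] = ≋-trans (∷-cong refl (*ₚ-cong f≋[] (≋-refl {g}))) 0∷[]≋[]
    coeff-ag : ∀ k → coeff ((a ∷ f) *ₚ g) k ≈ a * coeff g k
    coeff-ag k = trans (coeff-∷*ₚ a f g k) (trans (+-cong refl (coeff-≈ fg≋[] k)) (+-identityʳ _))
  *ₚ-leading (suc m) n (a ∷ f) g f-vanishes g-vanishes =
    trans (coeff-∷*ₚ a f g _) (trans (+-cong (a*gₖ≈0 (ℕ.m≤n+m n m)) (proj₁ ih)) (+-identityˡ _)) ,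
    λ { (suc k) (s≤s m+n<k) →
          trans (coeff-∷*ₚ a f g _) (trans (+-cong (a*gₖ≈0 (ℕ.m+n≤o⇒n≤o m (ℕ.<⇒≤ m+n<k))) (proj₂ ih k m+n<k)) (+-identityˡ _)) }
    where
    ih : coeff (f *ₚ g) (m ℕ.+ n) ≈ coeff f m * coeff g n × VanishesFrom (f *ₚ g) (suc (m ℕ.+ n))
    ih = *ₚ-leading m n f g (λ k m<k → f-vanishes (suc k) (s≤s m<k)) g-vanishes
    a*gₖ≈0 : ∀ {k} → n ≤ k → a * coeff g (suc k) ≈ 0#
    a*gₖ≈0 n≤k = trans (*-cong refl (g-vanishes _ (s≤s n≤k))) (zeroʳ a)

  HasDegree-*ₚ : ∀ {f g m n} → HasDegree f m → HasDegree g n → HasDegree (f *ₚ g) (m ℕ.+ n)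
  HasDegree-*ₚ {f} {g} {m} {n} (fₘ≉0 , f>m≈0) (gₙ≉0 , g>n≈0) =
    (λ e → *-≉0 fₘ≉0 gₙ≉0 (trans (sym (proj₁ leading)) e)) , proj₂ leading
    where
    leading : coeff (f *ₚ g) (m ℕ.+ n) ≈ coeff f m * coeff g n × VanishesFrom (f *ₚ g) (suc (m ℕ.+ n))
    leading = *ₚ-leading m n f g f>m≈0 g>n≈0

  *ₚ-HasDegree⇒HasDegreeˡ : ∀ {f g k} → HasDegree (f *ₚ g) k → ∃ (HasDegree f)
  *ₚ-HasDegree⇒HasDegreeˡ {f} {g} deg-fg with ≋[]⊎HasDegree f
  ... | inj₁ f≋[]   = contradiction deg-fg (≋[]⇒¬HasDegree (*ₚ-cong f≋[] (≋-refl {g})))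
  ... | inj₂ deg-f  = deg-f

  VanishesFrom⇒degree< : ∀ {f m n} → HasDegree f m → VanishesFrom f n → m < n
  VanishesFrom⇒degree< (fₘ≉0 , _) f≥n≈0 = ℕ.≰⇒> λ n≤m → fₘ≉0 (f≥n≈0 _ n≤m)

  -- Division with remainder and the descent

  module ℙ-identities = CommutativeRingIdentities Poly-commutativeRing

  divide : ∀ {f n} → HasDegree f n → ∀ g →
           ∃₂ λ s r → g ≋ ((f *ₚ s) +ₚ r) × VanishesFrom r n
  divide {f} _ [] = [] , [] , ≋-sym (≋-trans (+ₚ-identityʳ _) (*ₚ-zeroʳ f)) , λ _ _ → refl
  divide {f} {n} deg-f@(fₙ≉0 , f>n≈0) (b ∷ g) with divide {f} deg-f g | inverse (coeff f n) fₙ≉0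
  ... | s , r , g≋fs+r , r-vanishes | v , fₙv≈1 = w ∷ s , r' , b∷g≋ , r'-vanishes
    where
    B : Poly
    B = b ∷ r
    w : Carrier
    w = coeff B n * v
    r' : Poly
    r' = B +ₚ -ₚ map (w *_) f
    b∷g≋ : (b ∷ g) ≋ ((f *ₚ (w ∷ s)) +ₚ r')
    b∷g≋ = ≋-trans (∷-cong (sym (+-identityˡ b)) g≋fs+r)
      (≋-trans (ℙ-identities.x≈y+z⇒x≈w+y+[z-w] {y = 0# ∷ (f *ₚ s)} {z = B} (map (w *_) f) ≋-refl)
               (+ₚ-cong (≋-sym (*ₚ-∷ʳ f w s)) ≋-refl))
    coeff-r' : ∀ k → coeff r' k ≈ coeff B k + - (w * coeff f k)
    coeff-r' k = trans (coeff-+ₚ B (-ₚ map (w *_) f) k)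
                       (+-cong refl (trans (coeff--ₚ (map (w *_) f) k) (-‿cong (coeff-scale w f k))))
    w*fₙ≈Bₙ : w * coeff f n ≈ coeff B n
    w*fₙ≈Bₙ = begin
      (coeff B n * v) * coeff f n   ≈⟨ solve 3 (λ b v u → (b :* v) :* u := b :* (u :* v)) refl (coeff B n) v (coeff f n) ⟩
      coeff B n * (coeff f n * v)   ≈⟨ *-cong refl fₙv≈1 ⟩
      coeff B n * 1#                ≈⟨ *-identityʳ _ ⟩
      coeff B n                     ∎
    r'-vanishes : VanishesFrom r' n
    r'-vanishes k n≤k with ℕ.m≤n⇒m<n∨m≡n n≤k
    ... | inj₂ ≡.refl = trans (coeff-r' n) (trans (+-cong refl (-‿cong w*fₙ≈Bₙ)) (-‿inverseʳ _))
    ... | inj₁ n<k@(s≤s n≤k-1) = trans (coeff-r' k)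
      (trans (+-cong (r-vanishes _ n≤k-1) (-‿cong (trans (*-cong refl (f>n≈0 k n<k)) (zeroʳ w))))
             (trans (+-identityˡ _) -0#≈0#))

  cofactor-degree : ∀ {a f h r n d} → 0 < n → HasDegree f n → HasDegree h d → VanishesFrom r n →
                    ((f *ₚ h) +ₚ const a) ≋ (r *ₚ r) → ∃ λ m → n ℕ.+ d ≡ m ℕ.+ m × m < n
  cofactor-degree {a} {f} {h} {r} {n} {d} 0<n deg-f deg-h r-vanishes fh+a≋r² = m , n+d≡m+m , m<n
    where
    deg-r² : HasDegree (r *ₚ r) (n ℕ.+ d)
    deg-r² = HasDegree-cong {(f *ₚ h) +ₚ const a} fh+a≋r²
      (HasDegree-+ₚ-const {f *ₚ h} a (ℕ.<-≤-trans 0<n (ℕ.m≤m+n n d)) (HasDegree-*ₚ {f} {h} deg-f deg-h))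
    m = proj₁ (*ₚ-HasDegree⇒HasDegreeˡ {r} {r} deg-r²)
    deg-r : HasDegree r m
    deg-r = proj₂ (*ₚ-HasDegree⇒HasDegreeˡ {r} {r} deg-r²)
    n+d≡m+m : n ℕ.+ d ≡ m ℕ.+ m
    n+d≡m+m = HasDegree-unique {r *ₚ r} deg-r² (HasDegree-*ₚ {r} {r} deg-r deg-r)
    m<n : m < n
    m<n = VanishesFrom⇒degree< {r} deg-r r-vanishes

  odd-degree-divisor⇒square : ∀ {a f g h n} → HasDegree f n → n % 2 ≡ 1 →
                              ((f *ₚ h) +ₚ const a) ≋ (g *ₚ g) → ∃ λ x → x * x ≈ a
  odd-degree-divisor⇒square {a} {f} {g} {h} {n} = descent {a} {f} {g} {h} (<-wellFounded n)
    where
    descent : ∀ {a f g h n} → Acc _<_ n → HasDegree f n → n % 2 ≡ 1 →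
              ((f *ₚ h) +ₚ const a) ≋ (g *ₚ g) → ∃ λ x → x * x ≈ a
    descent {a} {f} {g} {h} {n} (acc rec) deg-f n-odd fh+a≋g² with divide {f} deg-f g
    ... | s , r , g≋fs+r , r-vanishes = descend (≋[]⊎HasDegree h')
      where
      h' : Poly
      h' = h ℙ.- (s *ₚ (g +ₚ r))
      fh'+a≋r² : ((f *ₚ h') +ₚ const a) ≋ (r *ₚ r)
      fh'+a≋r² = ℙ-identities.remainder-square {f} {h} {g} {s} {r} fh+a≋g² g≋fs+r
      descend : h' ≋ [] ⊎ ∃ (HasDegree h') → ∃ λ x → x * x ≈ a
      descend (inj₁ h'≋[]) = coeff r 0 , sym (trans (coeff-≈ a≋r² 0) (coeff-*ₚ-0 r r))
        where
        a≋r² : const a ≋ (r *ₚ r)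
        a≋r² = ≋-trans (+ₚ-cong (≋-sym (≋-trans (*ₚ-congʳ f h'≋[]) (*ₚ-zeroʳ f))) ≋-refl) fh'+a≋r²
      descend (inj₂ (d , deg-h')) =
        descend-to-h' (cofactor-degree {a} {f} {h'} {r} (odd⇒0< n-odd) deg-f deg-h' r-vanishes fh'+a≋r²)
        where
        descend-to-h' : (∃ λ m → n ℕ.+ d ≡ m ℕ.+ m × m < n) → ∃ λ x → x * x ≈ a
        descend-to-h' (m , n+d≡m+m , m<n) =
          descent {a} {h'} {r} {f} (rec d<n) deg-h' (odd-summand {n} {d} {m} n-odd n+d≡m+m)
                  (≋-trans (+ₚ-cong (*ₚ-comm h' f) ≋-refl) fh'+a≋r²)
          where
          d<n : d < n
          d<n = ℕ.+-cancelˡ-< n d n (≡.subst (_< n ℕ.+ n) (≡.sym n+d≡m+m) (ℕ.+-mono-< m<n m<n))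

  ∣ₚΔ₀⇒D²≡a : ∀ {D f c₂₇} → fromℕ 27 * c₂₇ ≈ 1# → f ∣ₚ Δ₀ D →
              ∃ λ h → ((f *ₚ h) +ₚ const (- fromℕ 4 * c₂₇)) ≋ (D *ₚ D)
  ∣ₚΔ₀⇒D²≡a {D} {f} {c₂₇} 27c₂₇≈1 (h , fh≈Δ₀) = const c₂₇ *ₚ h ,
    ≋-trans (+ₚ-cong (≋-refl {f *ₚ (const c₂₇ *ₚ h)}) (const-* (- fromℕ 4) c₂₇))
            (ℙ-identities.scaled-divisor {const (fromℕ 27)} {const c₂₇} {const (fromℕ 4)} {D *ₚ D} {f}
              (≋-trans (≋-sym (const-* (fromℕ 27) c₂₇)) (const-cong 27c₂₇≈1)) (mk≋ fh≈Δ₀))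

lemma6p2 : {c ℓ : Level} (q : ℕ) → IsPrimePower q → 3 < q
    → (F : FiniteField c ℓ q)
    → let open FiniteField F in let open Polynomials F in
    (D : Poly) → Monic D → Squarefree D
    → (c₂₇ : Carrier) → fromℕ 27 * c₂₇ ≈ 1#
    → NonResidue (- (fromℕ 4) * c₂₇)
    → (f : Poly) → Irreducible f → f ∣ₚ Δ₀ D
    → (n : ℕ) → HasDegree f n → n % 2 ≡ 0
lemma6p2 _ _ _ F D _ _ c₂₇ 27c₂₇≈1 (_ , a-non-square) f _ f∣Δ₀ n deg-f with n % 2 in n%2≡ | m%n<n n 2
... | 0           | _            = ≡.refl
... | 1           | _            = contradiction
  (odd-degree-divisor⇒square F {f = f} {g = D} deg-f n%2≡ (proj₂ (∣ₚΔ₀⇒D²≡a F {D} {f} 27c₂₇≈1 f∣Δ₀)))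
  a-non-square
... | suc (suc _) | s≤s (s≤s ())
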